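{- Let $n\ge 1$, $1\le m\le n$ and $0\le t\le m-1$ be integers, and let $Q=B_n(m,t)$ be the flag-shaped set of positions of an $n\times n$ matrix (which has cardinality $n+t(n-m)$). Then $Q$ is a blocker of all $n\times n$ $123$-avoiding permutation matrices, i.e. every $n\times n$ $123$-avoiding permutation matrix has a $1$ in at least one position of $Q$.
   Context: A permutation matrix $P$ contains a $123$-pattern if the $3\times 3$ identity matrix $I_3$ is a submatrix of $P$ (equivalently, the permutation has an increasing subsequence of length $3$); otherwise $P$ is $123$-avoiding. A set $Q$ of positions of an $n\times n$ matrix is a blocker (of $123$-avoiding permutation matrices) if every $n\times n$ $123$-avoiding permutation matrix has a $1$ in some position of $Q$. For integers $1\le m\le n$, $0\le t\le m-1$, the flag-shaped set $B_n(m,t)$ is the union of the "pole" $\{(i,m): 1\le i\le n-t\}$ (rows $1$ to $n-t$ of column $m$) and the "flag" $\{(i,j): 1\le i\le n-m+1,\ m-t\le j\le m-1\}$ (rows $1$ to $n-m+1$, columns $m-t$ to $m-1$). Positions are (row, column). -}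

module Defs where

open import Data.Nat using (ℕ; suc; _+_; _∸_; _≤_; _<_)
open import Data.Fin using (Fin; toℕ)
open import Data.Fin.Permutation using (Permutation′; _⟨$⟩ʳ_)
open import Data.Product using (Σ; ∃; _×_)
open import Data.Sum using (_⊎_)
open import Relation.Nullary using (¬_)
open import Relation.Binary.PropositionalEquality using (_≡_)

-- An n×n permutation matrix P_π has a 1 in position (i, π(i)).
-- Rows/columns are indexed by Fin n internally; the 1-based position
-- of row i is suc (toℕ i).

Contains123 : {n : ℕ} → Permutation′ n → Set
Contains123 {n} π =
  Σ (Fin n) λ i → Σ (Fin n) λ j → Σ (Fin n) λ k →
    (toℕ i < toℕ j) × (toℕ j < toℕ k) ×
    (toℕ (π ⟨$⟩ʳ i) < toℕ (π ⟨$⟩ʳ j)) × (toℕ (π ⟨$⟩ʳ j) < toℕ (π ⟨$⟩ʳ k))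

Avoids123 : {n : ℕ} → Permutation′ n → Set
Avoids123 π = ¬ Contains123 π

-- A set of positions, given as a predicate on 1-based (row, column) pairs.
PosSet : Set₁
PosSet = ℕ → ℕ → Set

-- The flag-shaped set B_n(m,t) (1-based positions):
--   pole: 1 ≤ i ≤ n - t, j = m
--   flag: 1 ≤ i ≤ n - m + 1, m - t ≤ j ≤ m - 1
B : ℕ → ℕ → ℕ → PosSet
B n m t i j =
  (1 ≤ i × i ≤ n ∸ t × j ≡ m)
  ⊎ (1 ≤ i × i ≤ n ∸ m + 1 × m ∸ t ≤ j × j ≤ m ∸ 1)


Blocker : ℕ → PosSet → Set
Blocker n Q = (π : Permutation′ n) → Avoids123 π →
  ∃ λ (i : Fin n) → Q (suc (toℕ i)) (suc (toℕ (π ⟨$⟩ʳ i)))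

{-# OPTIONS --safe #-}
-- Write k = m - 1 for the 0-based pole column, and suppose the permutation π
-- misses B. The rows 0 … n-m of the flag are n-m+1 rows which cannot all be
-- sent to the n-m columns right of the pole, so some flag row a has π a left
-- of the flag. The pole row p = π⁻¹ k lies below the pole, so p ≥ n - t; the t
-- flag columns cannot all be hit by the fewer than t rows below p, so some
-- flag column c is hit by a row q < p, and q lies below the flag. Then
-- a < q < p with π a < c < k is a 123-pattern.
module Submission where

open import Defs
open import Data.Nat using (ℕ; suc; _≤_; _<_; _∸_; _+_; z≤n; s≤s; s≤s⁻¹; _≤?_; _<?_)
import Data.Nat as ℕ
open import Data.Nat.Properties
open import Data.Fin using (Fin; toℕ; fromℕ<; inject≤; _↑ʳ_)
open import Data.Fin.Properties
  using (toℕ-injective; toℕ-fromℕ<; toℕ<n; toℕ-inject≤; inject≤-injective;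
         toℕ-↑ʳ; ↑ʳ-injective; any?; injective⇒≤)
open import Data.Fin.Permutation using (Permutation′; _⟨$⟩ʳ_; _⟨$⟩ˡ_; inverseˡ; inverseʳ; flip)
open import Data.Product using (_×_; _,_; ∃)
open import Data.Sum using (inj₁; inj₂)
open import Data.Empty using (⊥; ⊥-elim)
open import Function using (_∘_)
open import Function.Definitions using (Injective)
open import Relation.Nullary using (¬_; Dec; yes; no)
open import Relation.Nullary.Decidable using (_×-dec_; _⊎-dec_)
open import Relation.Binary.PropositionalEquality
  using (_≡_; _≢_; sym; trans; cong; subst; module ≡-Reasoning)

⟨$⟩ʳ-injective : ∀ {n} (π : Permutation′ n) → Injective _≡_ _≡_ (π ⟨$⟩ʳ_)
⟨$⟩ʳ-injective π {x} {y} πx≡πy =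
  trans (sym (inverseˡ π)) (trans (cong (π ⟨$⟩ˡ_) πx≡πy) (inverseˡ π))

injective-above⇒≤ : ∀ {k N} lo (f : Fin k → Fin N) → Injective _≡_ _≡_ f →
                    (∀ x → lo ≤ toℕ (f x)) → k ≤ N ∸ lo
injective-above⇒≤ {N = N} lo f f-inj above = injective⇒≤ g-inj
  where
  g : Fin _ → Fin (N ∸ lo)
  g x = fromℕ< (∸-monoˡ-< (toℕ<n (f x)) (above x))

  g-inj : Injective _≡_ _≡_ g
  g-inj {x} {y} gx≡gy = f-inj (toℕ-injective (∸-cancelʳ-≡ (above x) (above y) (begin
    toℕ (f x) ∸ lo ≡⟨ toℕ-fromℕ< _ ⟨
    toℕ (g x)      ≡⟨ cong toℕ gx≡gy ⟩
    toℕ (g y)      ≡⟨ toℕ-fromℕ< _ ⟩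
    toℕ (f y) ∸ lo ∎)))
    where open ≡-Reasoning

interval : ∀ {M} lo {k} → lo + k ≤ M → Fin k → Fin M
interval lo bound x = inject≤ (lo ↑ʳ x) bound

toℕ-interval : ∀ {M} lo {k} (bound : lo + k ≤ M) x → toℕ (interval lo bound x) ≡ lo + toℕ x
toℕ-interval lo bound x = trans (toℕ-inject≤ (lo ↑ʳ x) bound) (toℕ-↑ʳ lo x)

interval-injective : ∀ {M} lo {k} (bound : lo + k ≤ M) → Injective _≡_ _≡_ (interval lo bound)
interval-injective lo bound = ↑ʳ-injective lo _ _ ∘ inject≤-injective bound bound _ _

interval-above⇒≤ : ∀ {M N} (f : Fin M → Fin N) → Injective _≡_ _≡_ f →
                   ∀ lo k lo′ → lo + k ≤ M →
                   (∀ i → lo ≤ toℕ i → toℕ i < lo + k → lo′ ≤ toℕ (f i)) →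
                   k ≤ N ∸ lo′
interval-above⇒≤ f f-inj lo k lo′ bound above =
  injective-above⇒≤ lo′ (f ∘ interval lo bound)
    (interval-injective lo bound ∘ f-inj)
    (λ x → above (interval lo bound x)
      (subst (lo ≤_) (sym (toℕ-interval lo bound x)) (m≤m+n lo (toℕ x)))
      (subst (_< lo + k) (sym (toℕ-interval lo bound x)) (+-monoʳ-< lo (toℕ<n x))))

B? : ∀ n m t i j → Dec (B n m t i j)
B? n m t i j = ((1 ≤? i) ×-dec (i ≤? n ∸ t) ×-dec (j ℕ.≟ m))
        ⊎-dec ((1 ≤? i) ×-dec (i ≤? n ∸ m + 1) ×-dec (m ∸ t ≤? j) ×-dec (j ≤? m ∸ 1))

module _ {n k t : ℕ} (k<n : k < n) (t≤k : t ≤ k) (π : Permutation′ n)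
         (misses : ∀ i → ¬ B n (suc k) t (suc (toℕ i)) (suc (toℕ (π ⟨$⟩ʳ i)))) where

  private
    π⁻¹ : Fin n → Fin n
    π⁻¹ = flip π ⟨$⟩ʳ_

    toℕ-π∘π⁻¹ : ∀ c → toℕ (π ⟨$⟩ʳ π⁻¹ c) ≡ toℕ c
    toℕ-π∘π⁻¹ c = cong toℕ (inverseʳ π)

    misses-pole : ∀ i → toℕ i < n ∸ t → toℕ (π ⟨$⟩ʳ i) ≢ k
    misses-pole i i<n∸t πi≡k = misses i (inj₁ (s≤s z≤n , i<n∸t , cong suc πi≡k))

    misses-flag : ∀ i → toℕ i < n ∸ k → k ∸ t ≤ toℕ (π ⟨$⟩ʳ i) → toℕ (π ⟨$⟩ʳ i) < k → ⊥
    misses-flag i i<n∸k k∸t≤πi πi<k = misses i (inj₂ (s≤s z≤n ,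
      subst (suc (toℕ i) ≤_) (trans (+-∸-assoc 1 k<n) (+-comm 1 _)) i<n∸k ,
      subst (_≤ suc (toℕ (π ⟨$⟩ʳ i))) (sym (+-∸-assoc 1 t≤k)) (s≤s k∸t≤πi) , πi<k))

    n∸k≤n∸t : n ∸ k ≤ n ∸ t
    n∸k≤n∸t = ∸-monoʳ-≤ n t≤k

    poleRow : Fin n
    poleRow = π⁻¹ (fromℕ< k<n)

    π-poleRow : toℕ (π ⟨$⟩ʳ poleRow) ≡ k
    π-poleRow = trans (toℕ-π∘π⁻¹ _) (toℕ-fromℕ< k<n)

    poleRow-late : n ∸ t ≤ toℕ poleRow
    poleRow-late with suc (toℕ poleRow) ≤? n ∸ t
    ... | yes early = ⊥-elim (misses-pole poleRow early π-poleRow)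
    ... | no late   = s≤s⁻¹ (≰⇒> late)

    flag-row-hits-left : ∃ λ a → toℕ a < n ∸ k × toℕ (π ⟨$⟩ʳ a) < k ∸ t
    flag-row-hits-left with any? (λ a → (toℕ a <? n ∸ k) ×-dec (toℕ (π ⟨$⟩ʳ a) <? k ∸ t))
    ... | yes found = found
    ... | no none   = ⊥-elim (≤⇒≯ too-few-columns (∸-monoʳ-< (n<1+n k) k<n))
      where
      right-of-pole : ∀ a → 0 ≤ toℕ a → toℕ a < 0 + (n ∸ k) → suc k ≤ toℕ (π ⟨$⟩ʳ a)
      right-of-pole a _ a<n∸k with toℕ (π ⟨$⟩ʳ a) <? k ∸ t | toℕ (π ⟨$⟩ʳ a) <? k
      ... | yes left | _        = ⊥-elim (none (a , a<n∸k , left))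
      ... | no notLeft | yes πa<k = ⊥-elim (misses-flag a a<n∸k (≮⇒≥ notLeft) πa<k)
      ... | no _ | no k≤πa =
        ≤∧≢⇒< (≮⇒≥ k≤πa) (misses-pole a (<-≤-trans a<n∸k n∸k≤n∸t) ∘ sym)

      too-few-columns : n ∸ k ≤ n ∸ suc k
      too-few-columns =
        interval-above⇒≤ (π ⟨$⟩ʳ_) (⟨$⟩ʳ-injective π) 0 (n ∸ k) (suc k) (m∸n≤m n k) right-of-pole

    flag-column-hit-early : ∃ λ c → k ∸ t ≤ toℕ c × toℕ c < k × toℕ (π⁻¹ c) < toℕ poleRow
    flag-column-hit-early
      with any? (λ c → (k ∸ t ≤? toℕ c) ×-dec (toℕ c <? k) ×-dec (toℕ (π⁻¹ c) <? toℕ poleRow))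
    ... | yes found = found
    ... | no none   = ⊥-elim (<⇒≱ too-many-rows poleRow-late)
      where
      p : ℕ
      p = toℕ poleRow

      <k : ∀ {c} → c < k ∸ t + t → c < k
      <k = subst (_ <_) (m∸n+n≡m t≤k)

      below-pole-row : ∀ c → k ∸ t ≤ toℕ c → toℕ c < k ∸ t + t → suc p ≤ toℕ (π⁻¹ c)
      below-pole-row c k∸t≤c c<k∸t+t with toℕ (π⁻¹ c) <? p
      ... | yes early = ⊥-elim (none (c , k∸t≤c , <k c<k∸t+t , early))
      ... | no late = ≤∧≢⇒< (≮⇒≥ late) λ p≡π⁻¹c → <⇒≢ c<k (begin
          toℕ c                       ≡⟨ toℕ-π∘π⁻¹ c ⟨
          toℕ (π ⟨$⟩ʳ π⁻¹ c)         ≡⟨ cong (toℕ ∘ (π ⟨$⟩ʳ_)) (toℕ-injective p≡π⁻¹c) ⟨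
          toℕ (π ⟨$⟩ʳ poleRow)       ≡⟨ π-poleRow ⟩
          k                           ∎)
        where
        open ≡-Reasoning
        c<k : toℕ c < k
        c<k = <k c<k∸t+t

      few-rows-below : t ≤ n ∸ suc p
      few-rows-below = interval-above⇒≤ π⁻¹ (⟨$⟩ʳ-injective (flip π)) (k ∸ t) t (suc p)
        (subst (_≤ n) (sym (m∸n+n≡m t≤k)) (<⇒≤ k<n)) below-pole-row

      too-many-rows : suc p ≤ n ∸ t
      too-many-rows = m+n≤o⇒m≤o∸n (suc p)
        (subst (_≤ n) (+-comm t (suc p)) (m≤o∸n⇒m+n≤o t (toℕ<n poleRow) few-rows-below))

    flag-hit-below-flag : ∀ q → k ∸ t ≤ toℕ (π ⟨$⟩ʳ q) → toℕ (π ⟨$⟩ʳ q) < k → n ∸ k ≤ toℕ q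
    flag-hit-below-flag q k∸t≤πq πq<k with toℕ q <? n ∸ k
    ... | yes q<n∸k = ⊥-elim (misses-flag q q<n∸k k∸t≤πq πq<k)
    ... | no  late  = ≮⇒≥ late

  misses-B⇒Contains123 : Contains123 π
  misses-B⇒Contains123 with flag-row-hits-left | flag-column-hit-early
  ... | a , a<n∸k , πa<k∸t | c , k∸t≤c , c<k , q<p =
    a , q , poleRow ,
    <-≤-trans a<n∸k (flag-hit-below-flag q k∸t≤πq πq<k) , q<p ,
    <-≤-trans πa<k∸t k∸t≤πq , subst (toℕ (π ⟨$⟩ʳ q) <_) (sym π-poleRow) πq<k
    where
    q : Fin n
    q = π⁻¹ c
    k∸t≤πq : k ∸ t ≤ toℕ (π ⟨$⟩ʳ q)
    k∸t≤πq = subst (k ∸ t ≤_) (sym (toℕ-π∘π⁻¹ c)) k∸t≤c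
    πq<k : toℕ (π ⟨$⟩ʳ q) < k
    πq<k = subst (_< k) (sym (toℕ-π∘π⁻¹ c)) c<k

lemma2p1 : (n m t : ℕ) → 1 ≤ n → 1 ≤ m → m ≤ n → t ≤ m ∸ 1 →
    Blocker n (B n m t)
lemma2p1 n (suc k) t _ _ k<n t≤k π avoids
  with any? (λ i → B? n (suc k) t (suc (toℕ i)) (suc (toℕ (π ⟨$⟩ʳ i))))
... | yes hit = hit
... | no none = ⊥-elim (avoids (misses-B⇒Contains123 k<n t≤k π (λ i b → none (i , b))))
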